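{- Let $F$ be a one-dimensional cellular automaton with finite state set $A$, and for $y\in\mathbb{N}$ let $\mathcal{N}^{y}\subseteq\mathbb{Z}$ be the neighborhood of $F^{y}$. Let $x,x'\in\mathbb{Z}$ and $y,y',l,r,l',r'\in\mathbb{N}$. If $F$ has the properties $P(x,y,l,r)$ and $P(x',y',l',r')$, and $[x'-l';x'+r']+\mathcal{N}^{y'}\subseteq[-l;r]$, then $F$ has the property $P(x+x',y+y',l',r')$.
   Context: A one-dimensional cellular automaton (CA) with finite state set $A$ is identified with its global map $F:A^{\mathbb{Z}}\to A^{\mathbb{Z}}$ (continuous and commuting with the shift). The neighborhood $\mathcal{N}^y$ of $F^y$ is a finite set $N\subseteq\mathbb{Z}$ such that $F^y(c)_z$ depends only on the restriction of $c$ to $z+N$, for all $c$ and $z$. $[a;b]$ denotes the integer interval $\{a,\dots,b\}$ and $S+N=\{s+n: s\in S, n\in N\}$. For $c\in A^{\mathbb{Z}}$ and $q\in A$, $\phi_c(q)$ is the configuration equal to $q$ at position $0$ and to $c(z)$ at every $z\neq 0$. For $x\in\mathbb{Z}$, $y\in\mathbb{N}$, $F^y_{x,c}:A\to A$ is the map $q\mapsto (F^y(\phi_c(q)))_x$. For $x\in\mathbb{Z}$ and $y,l,r\in\mathbb{N}$, $F$ has property $P(x,y,l,r)$ if (1) $F^y_{x,c}$ is a bijection for every configuration $c$, and (2) $F^y_{z,c}$ is constant for every configuration $c$ and every integer $z\in[x-l;x+r]\setminus\{x\}$. -}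

module Defs where

open import Data.Nat using (ℕ; zero; suc)
open import Data.Integer using (ℤ; +_; _+_; _-_; -_; _≤_; _≟_)
open import Data.Fin using (Fin)
open import Data.List using (List)
open import Data.List.Membership.Propositional using (_∈_)
open import Data.Product using (_×_; Σ; ∃)
open import Relation.Binary.PropositionalEquality using (_≡_; _≢_)
open import Relation.Nullary using (yes; no)
open import Function.Bundles using (_↔_)
open import Function.Definitions using (Bijective)

Config : Set → Set
Config A = ℤ → A

σ : {A : Set} → Config A → Config A
σ c z = c (z + + 1)

FiniteSet : Set → Set
FiniteSet A = Σ ℕ (λ n → A ↔ Fin n)

AgreeOn : {A : Set} → ℤ → ℤ → Config A → Config A → Set
AgreeOn a b c c' = ∀ z → a ≤ z → z ≤ b → c z ≡ c' z

-- continuity of G : A^ℤ → A^ℤ (product of discrete topologies):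
-- each output cell is determined by a finite window of the input
Continuous : {A : Set} → (Config A → Config A) → Set
Continuous G = ∀ c z → ∃ λ (m : ℕ) →
  ∀ c' → AgreeOn (z - + m) (z + + m) c c' → G c z ≡ G c' z

IsCA : {A : Set} → (Config A → Config A) → Set
IsCA F = Continuous F × (∀ c → ∀ z → F (σ c) z ≡ σ (F c) z)

iter : {A : Set} → (Config A → Config A) → ℕ → Config A → Config A
iter F zero c = c
iter F (suc y) c = F (iter F y c)

IsNeighborhood : {A : Set} → (Config A → Config A) → List ℤ → Set
IsNeighborhood G N = ∀ c c' z →
  (∀ n → n ∈ N → c (z + n) ≡ c' (z + n)) → G c z ≡ G c' z

φ : {A : Set} → Config A → A → Config A
φ c q z with z ≟ + 0
... | yes _ = q
... | no _ = c z

localMap : {A : Set} → (Config A → Config A) → ℕ → ℤ → Config A → A → A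
localMap F y x c q = iter F y (φ c q) x

P : {A : Set} → (Config A → Config A) → ℤ → ℕ → ℕ → ℕ → Set
P F x y l r =
  (∀ c → Bijective _≡_ _≡_ (localMap F y x c))
  × (∀ c z → x - + l ≤ z → z ≤ x + + r → z ≢ x →
       ∀ q q' → localMap F y z c q ≡ localMap F y z c q')

IntervalSumSubset : ℤ → ℤ → List ℤ → ℤ → ℤ → Set
IntervalSumSubset a b N a' b' = ∀ u n → a ≤ u → u ≤ b → n ∈ N →
  (a' ≤ u + n) × (u + n ≤ b')

-- After y steps, P(x,y,l,r) says that on the window x + [-l;r] the configuration F^y(φ_c(q))
-- is the fixed configuration e = F^y(c) translated by x, except at the cell x itself, which
-- holds F^y_{x,c}(q). The inclusion hypothesis makes the next y' steps near x + x' read only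
-- that window, so F^{y+y'}_{x+x',c} = F^{y'}_{x',e} ∘ F^y_{x,c} is a composite of bijections,
-- and F^{y+y'}_{z,c} factors through the constant map F^{y'}_{z-x,e} for the other cells z.
module Submission where

open import Defs
open import Data.Nat using (ℕ; zero; suc) renaming (_+_ to _+ℕ_)
import Data.Nat.Properties as ℕ
open import Data.Integer using (ℤ; +_; -[1+_]; _+_; _-_; -_; _≤_; _≟_)
open import Data.Integer.Properties
  using (+-identityˡ; +-identityʳ; +-inverseˡ; +-assoc; pos-+; +-monoʳ-≤; +-monoˡ-≤; i-j≤i; i≤i+j)
open import Data.Integer.Tactic.RingSolver using (solve-∀)
open import Data.List using (List)
open import Data.Product using (_,_; proj₁; proj₂)
open import Function using (_∘_)
open import Function.Definitions using (Bijective)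
import Function.Construct.Composition as Composition
open import Relation.Binary.PropositionalEquality
open import Relation.Nullary using (yes; no)
open ≡-Reasoning

i+[-i+j]≡j : ∀ i j → i + (- i + j) ≡ j
i+[-i+j]≡j = solve-∀

-i+[i+j]≡j : ∀ i j → - i + (i + j) ≡ j
-i+[i+j]≡j = solve-∀

i+[j-i]≡j : ∀ i j → i + (j - i) ≡ j
i+[j-i]≡j = solve-∀

[i+j]-i≡j : ∀ i j → (i + j) - i ≡ j
[i+j]-i≡j = solve-∀

+[1+m]+i≡+m+[i+1] : ∀ m i → + suc m + i ≡ + m + (i + + 1)
+[1+m]+i≡+m+[i+1] m i = trans (cong (_+ i) (pos-+ 1 m)) (1+j+i≡j+[i+1] (+ m) i)
  where
  1+j+i≡j+[i+1] : ∀ j i → + 1 + j + i ≡ j + (i + + 1)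
  1+j+i≡j+[i+1] = solve-∀

i+j≡i⇒j≡0 : ∀ {i j} → i + j ≡ i → j ≡ + 0
i+j≡i⇒j≡0 {i} {j} i+j≡i = begin
  j             ≡⟨ -i+[i+j]≡j i j ⟨
  - i + (i + j) ≡⟨ cong (_+_ (- i)) i+j≡i ⟩
  - i + i       ≡⟨ +-inverseˡ i ⟩
  + 0           ∎

i+j≤k⇒j≤k-i : ∀ i {j k} → i + j ≤ k → j ≤ k - i
i+j≤k⇒j≤k-i i {j} p = subst (_≤ _) ([i+j]-i≡j i j) (+-monoˡ-≤ (- i) p)

k≤i+j⇒k-i≤j : ∀ i {j k} → k ≤ i + j → k - i ≤ j
k≤i+j⇒k-i≤j i {j} p = subst (_ ≤_) ([i+j]-i≡j i j) (+-monoˡ-≤ (- i) p)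

Bijective-resp-≗ : ∀ {B C : Set} {f g : B → C} → f ≗ g →
  Bijective _≡_ _≡_ f → Bijective _≡_ _≡_ g
Bijective-resp-≗ f≗g (f-inj , f-surj) =
  (λ gb≡gb' → f-inj (trans (f≗g _) (trans gb≡gb' (sym (f≗g _))))) ,
  λ t → proj₁ (f-surj t) , λ b≡a → trans (sym (f≗g _)) (proj₂ (f-surj t) b≡a)

translate : {A : Set} → ℤ → Config A → Config A
translate k c w = c (k + w)

φ-self : {A : Set} (c : Config A) → φ c (c (+ 0)) ≗ c
φ-self c z with z ≟ + 0
... | yes refl = refl
... | no _     = refl

iter-+ : {A : Set} (F : Config A → Config A) (a b : ℕ) (c : Config A) →
  iter F (a +ℕ b) c ≡ iter F a (iter F b c)
iter-+ F zero    b c = refl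
iter-+ F (suc a) b c = cong F (iter-+ F a b c)

module _ {A : Set} {F : Config A → Config A} (isCA : IsCA F) where

  F-cong : ∀ {c c'} → c ≗ c' → F c ≗ F c'
  F-cong {c} {c'} c≗c' z = proj₂ (proj₁ isCA c z) c' (λ w _ _ → c≗c' w)

  iter-cong : ∀ n {c c'} → c ≗ c' → iter F n c ≗ iter F n c'
  iter-cong zero    c≗c' = c≗c'
  iter-cong (suc n) c≗c' = F-cong (iter-cong n c≗c')

  F-translate-+ : ∀ m c → F (translate (+ m) c) ≗ translate (+ m) (F c)
  F-translate-+ zero c w = begin
    F (translate (+ 0) c) w ≡⟨ F-cong (cong c ∘ +-identityˡ) w ⟩
    F c w                   ≡⟨ cong (F c) (+-identityˡ w) ⟨
    F c (+ 0 + w)           ∎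
  F-translate-+ (suc m) c w = begin
    F (translate (+ suc m) c) w      ≡⟨ F-cong (cong c ∘ +[1+m]+i≡+m+[i+1] m) w ⟩
    F (σ (translate (+ m) c)) w      ≡⟨ proj₂ isCA (translate (+ m) c) w ⟩
    F (translate (+ m) c) (w + + 1)  ≡⟨ F-translate-+ m c (w + + 1) ⟩
    F c (+ m + (w + + 1))            ≡⟨ cong (F c) (+[1+m]+i≡+m+[i+1] m w) ⟨
    F c (+ suc m + w)                ∎

  -- A negative translation is undone by the positive one, which commutes with F.
  F-translate : ∀ k c → F (translate k c) ≗ translate k (F c)
  F-translate (+ m) = F-translate-+ m
  F-translate k@(-[1+ m ]) c w = begin
    F (translate k c) w                           ≡⟨ cong (F (translate k c)) (-i+[i+j]≡j k w) ⟨
    F (translate k c) (- k + (k + w))             ≡⟨ F-translate-+ (suc m) (translate k c) (k + w) ⟨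
    F (translate (- k) (translate k c)) (k + w)   ≡⟨ F-cong (cong c ∘ i+[-i+j]≡j k) (k + w) ⟩
    F c (k + w)                                   ∎

  iter-translate : ∀ n k c → iter F n (translate k c) ≗ translate k (iter F n c)
  iter-translate zero    k c w = refl
  iter-translate (suc n) k c w =
    trans (F-cong (iter-translate n k c) w) (F-translate k (iter F n c) w)

  iter-φ-around : ∀ x y {l r} → P F x y l r → ∀ c q {w} → - + l ≤ w → w ≤ + r →
    iter F y (φ c q) (x + w) ≡ φ (translate x (iter F y c)) (localMap F y x c q) w
  iter-φ-around x y (_ , constant) c q {w} l≤w w≤r with w ≟ + 0
  ... | yes refl = cong (iter F y (φ c q)) (+-identityʳ x)
  ... | no w≢0   = trans
    (constant c (x + w) (+-monoʳ-≤ x l≤w) (+-monoʳ-≤ x w≤r) (w≢0 ∘ i+j≡i⇒j≡0) q (c (+ 0)))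
    (iter-cong y (φ-self c) (x + w))

  localMap-+ : ∀ x x' y y' {l r l' r'} {N' : List ℤ} →
    IsNeighborhood (iter F y') N' → P F x y l r →
    IntervalSumSubset (x' - + l') (x' + + r') N' (- (+ l)) (+ r) →
    ∀ c q {u} → x' - + l' ≤ u → u ≤ x' + + r' →
    localMap F (y +ℕ y') (x + u) c q
      ≡ localMap F y' u (translate x (iter F y c)) (localMap F y x c q)
  localMap-+ x x' y y' neighborhood Px sub c q {u} lo hi = begin
    iter F (y +ℕ y') (φ c q) (x + u)
      ≡⟨ cong (λ n → iter F n (φ c q) (x + u)) (ℕ.+-comm y y') ⟩
    iter F (y' +ℕ y) (φ c q) (x + u)
      ≡⟨ cong-app (iter-+ F y' y (φ c q)) (x + u) ⟩
    iter F y' (iter F y (φ c q)) (x + u)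
      ≡⟨ iter-translate y' x (iter F y (φ c q)) u ⟨
    iter F y' (translate x (iter F y (φ c q))) u
      ≡⟨ neighborhood _ _ u (λ n n∈N' →
           let (l≤u+n , u+n≤r) = sub u n lo hi n∈N' in iter-φ-around x y Px c q l≤u+n u+n≤r) ⟩
    iter F y' (φ (translate x (iter F y c)) (localMap F y x c q)) u
      ∎

lemma2 : {A : Set} → FiniteSet A → (F : Config A → Config A) → IsCA F →
    (x x' : ℤ) (y y' l r l' r' : ℕ) (N' : List ℤ) →
    IsNeighborhood (iter F y') N' →
    P F x y l r → P F x' y' l' r' →
    IntervalSumSubset (x' - + l') (x' + + r') N' (- (+ l)) (+ r) →
    P F (x + x') (y +ℕ y') l' r'
lemma2 _ F isCA x x' y y' l r l' r' N' neighborhood Px Px' sub = bijective , constant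
  where
  e : Config _ → Config _
  e c = translate x (iter F y c)

  decompose : ∀ c q {u} → x' - + l' ≤ u → u ≤ x' + + r' →
    localMap F (y +ℕ y') (x + u) c q ≡ localMap F y' u (e c) (localMap F y x c q)
  decompose = localMap-+ isCA x x' y y' neighborhood Px sub

  bijective : ∀ c → Bijective _≡_ _≡_ (localMap F (y +ℕ y') (x + x') c)
  bijective c = Bijective-resp-≗
    (λ q → sym (decompose c q (i-j≤i x' (+ l')) (i≤i+j x' (+ r'))))
    (Composition.bijective _≡_ _≡_ _≡_ (proj₁ Px c) (proj₁ Px' (e c)))

  constant : ∀ c z → (x + x') - + l' ≤ z → z ≤ (x + x') + + r' → z ≢ x + x' →
    ∀ q q' → localMap F (y +ℕ y') z c q ≡ localMap F (y +ℕ y') z c q'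
  constant c z lo hi z≢x+x' q q' = begin
    localMap F (y +ℕ y') z c q                     ≡⟨ cong (λ t → localMap F (y +ℕ y') t c q) z≡x+u ⟩
    localMap F (y +ℕ y') (x + u) c q               ≡⟨ decompose c q lo' hi' ⟩
    localMap F y' u (e c) (localMap F y x c q)     ≡⟨ proj₂ Px' (e c) u lo' hi' u≢x' _ _ ⟩
    localMap F y' u (e c) (localMap F y x c q')    ≡⟨ decompose c q' lo' hi' ⟨
    localMap F (y +ℕ y') (x + u) c q'              ≡⟨ cong (λ t → localMap F (y +ℕ y') t c q') z≡x+u ⟨
    localMap F (y +ℕ y') z c q'                    ∎
    where
    u = z - x
    z≡x+u : z ≡ x + u
    z≡x+u = sym (i+[j-i]≡j x z)
    lo' : x' - + l' ≤ u
    lo' = i+j≤k⇒j≤k-i x (subst (_≤ z) (+-assoc x x' (- + l')) lo)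
    hi' : u ≤ x' + + r'
    hi' = k≤i+j⇒k-i≤j x (subst (z ≤_) (+-assoc x x' (+ r')) hi)
    u≢x' : u ≢ x'
    u≢x' u≡x' = z≢x+x' (trans z≡x+u (cong (_+_ x) u≡x'))
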